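{- Let $\mathbb{D}$ be a countable set, $(G,+)$ a commutative group, and $V$ a finite, reversible set of data vectors $\mathbb{D}\to G$ such that $\bigcup_{\vec{v}\in V}\mathrm{supp}(\vec{v})\subsetneq\mathbb{D}$. Then for every $g$ in the subgroup of $G$ generated by $\{\vec{v}(\delta)\mid\delta\in\mathbb{D},\ \vec{v}\in V\}$ and all $\alpha,\beta\in\mathbb{D}$, the data vector $[\alpha\mapsto g]-[\beta\mapsto g]$ is a permutation sum of $V$.
   Context: A data vector is a function $\mathbb{D}\to G$ with finite support $\mathrm{supp}(\vec{v})=\{\alpha\mid\vec{v}(\alpha)\neq0\}$; addition and negation are pointwise. $\vec{y}$ is a permutation sum of $V$ if $\vec{y}=\sum_{i=1}^n\vec{v_i}\circ\theta_i$ for some $n\in\mathbb{N}$, $\vec{v_i}\in V$ (repetitions allowed) and permutations $\theta_i$ of $\mathbb{D}$. $V$ is reversible if for every $\vec{v}\in V$ both $\vec{v}$ and $-\vec{v}$ are permutation sums of $V$. For $g\in G$, $\alpha\in\mathbb{D}$, $[\alpha\mapsto g]$ is the data vector mapping $\alpha$ to $g$ and every other element to $0$. -}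

module Defs where

open import Level using (Level; _⊔_)
open import Algebra.Bundles using (AbelianGroup)
open import Data.Nat using (ℕ)
open import Data.Product using (Σ; ∃; _×_; _,_; proj₁; proj₂)
open import Data.List using (List; []; _∷_; foldr)
open import Data.List.Membership.Propositional using (_∈_)
open import Data.List.Relation.Unary.All using (All)
open import Function using (_∘_)
open import Function.Bundles using (_↔_; Inverse)
open import Function.Definitions using (Injective)
open import Relation.Binary.PropositionalEquality using (_≡_; cong)
open import Relation.Nullary using (Dec; yes; no; ¬_)
import Data.Nat.Properties as ℕP

Countable : Set → Set
Countable D = Σ (D → ℕ) (λ enc → Injective _≡_ _≡_ enc)

countable-≟ : {D : Set} → Countable D → (x y : D) → Dec (x ≡ y)
countable-≟ (enc , inj) x y with enc x ℕP.≟ enc y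
... | yes e = yes (inj e)
... | no ne = no (λ e → ne (cong enc e))

module DataVectors {c ℓ : Level} (G : AbelianGroup c ℓ) (D : Set) where
  open AbelianGroup G renaming (Carrier to Gc)

  DV : Set c
  DV = D → Gc

  _≈v_ : DV → DV → Set ℓ
  u ≈v w = ∀ x → u x ≈ w x

  _+v_ : DV → DV → DV
  (u +v w) x = u x ∙ w x

  -v_ : DV → DV
  (-v u) x = u x ⁻¹

  _-v_ : DV → DV → DV
  u -v w = u +v (-v w)

  0v : DV
  0v _ = ε

  FiniteSupport : DV → Set ℓ
  FiniteSupport v = Σ (List D) (λ L → ∀ α → ¬ (v α ≈ ε) → α ∈ L)

  Perm : Set
  Perm = D ↔ D

  sumPerm : List (DV × Perm) → DV
  sumPerm = foldr (λ p acc → (proj₁ p ∘ Inverse.to (proj₂ p)) +v acc) 0v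

  PermSum : List DV → DV → Set (c ⊔ ℓ)
  PermSum V y = Σ (List (DV × Perm)) (λ ps →
                  All (λ p → proj₁ p ∈ V) ps × (y ≈v sumPerm ps))

  Reversible : List DV → Set (c ⊔ ℓ)
  Reversible V = ∀ {v} → v ∈ V → PermSum V v × PermSum V (-v v)

  data InGen (V : List DV) : Gc → Set (c ⊔ ℓ) where
    gen  : ∀ {v} → v ∈ V → ∀ δ → InGen V (v δ)
    zero : InGen V ε
    add  : ∀ {g h} → InGen V g → InGen V h → InGen V (g ∙ h)
    neg  : ∀ {g} → InGen V g → InGen V (g ⁻¹)
    resp : ∀ {g h} → g ≈ h → InGen V g → InGen V h

  single : Countable D → D → Gc → DV
  single cD α g x with countable-≟ cD x α
  ... | yes _ = g
  ... | no  _ = ε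

-- Reversibility gives, for each v ∈ V, both v and −v as permutation sums; if v γ = g and
-- v δ = 0 for some γ ≠ δ, then v − v ∘ (γ δ) is exactly [γ ↦ g] − [δ ↦ g], and relabelling
-- moves (γ, δ) to any pair (α, β). A point δ outside every support exists by hypothesis, so
-- this covers every generator v γ, and the g for which all these differences are permutation
-- sums form a subgroup.
module Submission where

open import Defs
open import Level using (Level)
open import Algebra.Bundles using (AbelianGroup)
open import Data.Product using (Σ; _×_; _,_; proj₁; proj₂)
open import Data.List using (List; []; _∷_; _++_; map)
open import Data.List.Membership.Propositional using (_∈_)
open import Data.List.Relation.Unary.All using (All; []; _∷_)
open import Data.List.Relation.Unary.All.Properties using (++⁺)
open import Data.Empty using (⊥-elim)
open import Function using (_∘_)
open import Function.Bundles using (_↔_; Inverse; mk↔ₛ′)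
open import Function.Construct.Composition using (_↔-∘_)
open import Relation.Binary.Definitions using (DecidableEquality)
open import Relation.Binary.PropositionalEquality using (_≡_; _≢_)
import Relation.Binary.PropositionalEquality as ≡
open import Relation.Nullary using (Dec; yes; no)
import Algebra.Properties.AbelianGroup as AbelianGroupProperties
import Algebra.Properties.CommutativeSemigroup as CommutativeSemigroupProperties
import Relation.Binary.Reasoning.Setoid as SetoidReasoning

module Transposition {D : Set} (_≟_ : DecidableEquality D) where
  open ≡ using (refl; sym; trans; cong)

  swap : D → D → D → D
  swap a b x with x ≟ a
  ... | yes _ = b
  ... | no _ with x ≟ b
  ... |   yes _ = a
  ... |   no _ = x

  swap-left : ∀ a b → swap a b a ≡ b
  swap-left a b with a ≟ a
  ... | yes _ = refl
  ... | no a≢a = ⊥-elim (a≢a refl)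

  swap-right : ∀ a b → swap a b b ≡ a
  swap-right a b with b ≟ a
  ... | yes b≡a = b≡a
  ... | no _ with b ≟ b
  ... |   yes _ = refl
  ... |   no b≢b = ⊥-elim (b≢b refl)

  swap-other : ∀ a b {x} → x ≢ a → x ≢ b → swap a b x ≡ x
  swap-other a b {x} x≢a x≢b with x ≟ a
  ... | yes x≡a = ⊥-elim (x≢a x≡a)
  ... | no _ with x ≟ b
  ... |   yes x≡b = ⊥-elim (x≢b x≡b)
  ... |   no _ = refl

  swap-involutive : ∀ a b x → swap a b (swap a b x) ≡ x
  swap-involutive a b x with x ≟ a
  ... | yes refl = swap-right x b
  ... | no x≢a with x ≟ b
  ... |   yes refl = swap-left a x
  ... |   no x≢b = swap-other a b x≢a x≢b

  swap-injective : ∀ a b {x y} → swap a b x ≡ swap a b y → x ≡ y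
  swap-injective a b {x} {y} eq = begin
    x                     ≡⟨ sym (swap-involutive a b x) ⟩
    swap a b (swap a b x) ≡⟨ cong (swap a b) eq ⟩
    swap a b (swap a b y) ≡⟨ swap-involutive a b y ⟩
    y                     ∎
    where open ≡.≡-Reasoning

  transposition : D → D → D ↔ D
  transposition a b = mk↔ₛ′ (swap a b) (swap a b) (swap-involutive a b) (swap-involutive a b)

  -- First swap α with a, then the image β′ of β with b; the second swap fixes a since β′ ≠ a.
  permutation-mapping-pair : ∀ {α β a b} → α ≢ β → a ≢ b →
    Σ (D ↔ D) λ π → Inverse.to π α ≡ a × Inverse.to π β ≡ b
  permutation-mapping-pair {α} {β} {a} {b} α≢β a≢b =
    transposition β′ b ↔-∘ transposition α a , α↦a , swap-left β′ b
    where
    β′ = swap α a β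
    a≢β′ : a ≢ β′
    a≢β′ a≡β′ = α≢β (swap-injective α a (trans (swap-left α a) a≡β′))
    α↦a : swap β′ b (swap α a α) ≡ a
    α↦a rewrite swap-left α a = swap-other β′ b a≢β′ a≢b

module PermutationSums {c ℓ : Level} (G : AbelianGroup c ℓ) (D : Set)
                       (V : List (DataVectors.DV G D)) where
  open AbelianGroup G
  open DataVectors G D

  permSum-respˡ : ∀ {y z} → y ≈v z → PermSum V z → PermSum V y
  permSum-respˡ y≈z (ps , ps∈V , z≈) = ps , ps∈V , λ x → trans (y≈z x) (z≈ x)

  permSum-0 : ∀ {y} → y ≈v 0v → PermSum V y
  permSum-0 y≈0 = [] , [] , y≈0

  sumPerm-++ : ∀ ps qs x → sumPerm (ps ++ qs) x ≈ (sumPerm ps +v sumPerm qs) x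
  sumPerm-++ []       qs x = sym (identityˡ _)
  sumPerm-++ (p ∷ ps) qs x = trans (∙-congˡ (sumPerm-++ ps qs x)) (sym (assoc _ _ _))

  permSum-+ : ∀ {y z} → PermSum V y → PermSum V z → PermSum V (y +v z)
  permSum-+ (ps , ps∈V , y≈) (qs , qs∈V , z≈) =
    ps ++ qs , ++⁺ ps∈V qs∈V ,
    λ x → trans (∙-cong (y≈ x) (z≈ x)) (sym (sumPerm-++ ps qs x))

  relabel : Perm → List (DV × Perm) → List (DV × Perm)
  relabel π = map λ (v , θ) → v , θ ↔-∘ π

  relabel-∈ : ∀ π {ps} → All (λ p → proj₁ p ∈ V) ps → All (λ p → proj₁ p ∈ V) (relabel π ps)
  relabel-∈ π []         = []
  relabel-∈ π (v∈ ∷ ps∈) = v∈ ∷ relabel-∈ π ps∈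

  sumPerm-relabel : ∀ π ps x → sumPerm ps (Inverse.to π x) ≈ sumPerm (relabel π ps) x
  sumPerm-relabel π []       x = refl
  sumPerm-relabel π (p ∷ ps) x = ∙-congˡ (sumPerm-relabel π ps x)

  permSum-∘ : ∀ {y} (π : Perm) → PermSum V y → PermSum V (y ∘ Inverse.to π)
  permSum-∘ π (ps , ps∈V , y≈) =
    relabel π ps , relabel-∈ π ps∈V ,
    λ x → trans (y≈ (Inverse.to π x)) (sumPerm-relabel π ps x)

module Singles {c ℓ : Level} (G : AbelianGroup c ℓ) (D : Set) (cD : Countable D) where
  open AbelianGroup G renaming (Carrier to Gc)
  open DataVectors G D
  open AbelianGroupProperties G using (ε⁻¹≈ε)

  [_↦_] : D → Gc → DV
  [_↦_] = single cD

  single-at : ∀ α g {x} → x ≡ α → [ α ↦ g ] x ≡ g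
  single-at α g {x} x≡α with countable-≟ cD x α
  ... | yes _ = ≡.refl
  ... | no x≢α = ⊥-elim (x≢α x≡α)

  single-off : ∀ α g {x} → x ≢ α → [ α ↦ g ] x ≡ ε
  single-off α g {x} x≢α with countable-≟ cD x α
  ... | yes x≡α = ⊥-elim (x≢α x≡α)
  ... | no _ = ≡.refl

  single-∙ : ∀ α g h x → [ α ↦ g ∙ h ] x ≈ [ α ↦ g ] x ∙ [ α ↦ h ] x
  single-∙ α g h x with countable-≟ cD x α
  ... | yes _ = refl
  ... | no _ = sym (identityˡ ε)

  single-⁻¹ : ∀ α g x → [ α ↦ g ⁻¹ ] x ≈ [ α ↦ g ] x ⁻¹
  single-⁻¹ α g x with countable-≟ cD x α
  ... | yes _ = refl
  ... | no _ = sym ε⁻¹≈ε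

  single-cong : ∀ α {g h} → g ≈ h → ∀ x → [ α ↦ g ] x ≈ [ α ↦ h ] x
  single-cong α g≈h x with countable-≟ cD x α
  ... | yes _ = g≈h
  ... | no _ = refl

  single-ε : ∀ α x → [ α ↦ ε ] x ≈ ε
  single-ε α x with countable-≟ cD x α
  ... | yes _ = refl
  ... | no _ = refl

module Spreading {c ℓ : Level} (G : AbelianGroup c ℓ) (D : Set) (cD : Countable D)
                 (V : List (DataVectors.DV G D)) where
  open AbelianGroup G renaming (Carrier to Gc)
  open AbelianGroupProperties G using (⁻¹-∙-comm; ⁻¹-involutive)
  open CommutativeSemigroupProperties commutativeSemigroup using (interchange)
  open SetoidReasoning setoid
  open DataVectors G D
  open PermutationSums G D V
  open Singles G D cD
  open Transposition (countable-≟ cD)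

  Spreads : Gc → Set _
  Spreads g = ∀ α β → PermSum V ([ α ↦ g ] -v [ β ↦ g ])

  spreads-ε : Spreads ε
  spreads-ε α β = permSum-0 λ x → begin
    [ α ↦ ε ] x ∙ [ β ↦ ε ] x ⁻¹ ≈⟨ ∙-cong (single-ε α x) (⁻¹-cong (single-ε β x)) ⟩
    ε ∙ ε ⁻¹                     ≈⟨ inverseʳ ε ⟩
    ε                            ∎

  spreads-cong : ∀ {g h} → g ≈ h → Spreads g → Spreads h
  spreads-cong g≈h spreads-g α β = permSum-respˡ
    (λ x → ∙-cong (single-cong α (sym g≈h) x) (⁻¹-cong (single-cong β (sym g≈h) x)))
    (spreads-g α β)

  ∙-⁻¹-interchange : ∀ w x y z → (w ∙ x) ∙ (y ∙ z) ⁻¹ ≈ (w ∙ y ⁻¹) ∙ (x ∙ z ⁻¹)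
  ∙-⁻¹-interchange w x y z = begin
    (w ∙ x) ∙ (y ∙ z) ⁻¹      ≈⟨ ∙-congˡ (⁻¹-∙-comm y z) ⟨
    (w ∙ x) ∙ (y ⁻¹ ∙ z ⁻¹)   ≈⟨ interchange w x (y ⁻¹) (z ⁻¹) ⟩
    (w ∙ y ⁻¹) ∙ (x ∙ z ⁻¹)   ∎

  spreads-∙ : ∀ {g h} → Spreads g → Spreads h → Spreads (g ∙ h)
  spreads-∙ {g} {h} spreads-g spreads-h α β = permSum-respˡ
    (λ x → begin
      [ α ↦ g ∙ h ] x ∙ [ β ↦ g ∙ h ] x ⁻¹
        ≈⟨ ∙-cong (single-∙ α g h x) (⁻¹-cong (single-∙ β g h x)) ⟩
      ([ α ↦ g ] x ∙ [ α ↦ h ] x) ∙ ([ β ↦ g ] x ∙ [ β ↦ h ] x) ⁻¹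
        ≈⟨ ∙-⁻¹-interchange _ _ _ _ ⟩
      ([ α ↦ g ] x ∙ [ β ↦ g ] x ⁻¹) ∙ ([ α ↦ h ] x ∙ [ β ↦ h ] x ⁻¹) ∎)
    (permSum-+ (spreads-g α β) (spreads-h α β))

  spreads-⁻¹ : ∀ {g} → Spreads g → Spreads (g ⁻¹)
  spreads-⁻¹ {g} spreads-g α β = permSum-respˡ
    (λ x → begin
      [ α ↦ g ⁻¹ ] x ∙ [ β ↦ g ⁻¹ ] x ⁻¹
        ≈⟨ ∙-cong (single-⁻¹ α g x) (⁻¹-cong (single-⁻¹ β g x)) ⟩
      [ α ↦ g ] x ⁻¹ ∙ [ β ↦ g ] x ⁻¹ ⁻¹ ≈⟨ ∙-congˡ (⁻¹-involutive _) ⟩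
      [ α ↦ g ] x ⁻¹ ∙ [ β ↦ g ] x       ≈⟨ comm _ _ ⟩
      [ β ↦ g ] x ∙ [ α ↦ g ] x ⁻¹       ∎)
    (spreads-g β α)

  single-difference : ∀ {y g a b} → a ≢ b → y a ≈ g → y b ≈ ε →
                      ([ a ↦ g ] -v [ b ↦ g ]) ≈v (y -v (y ∘ swap a b))
  single-difference {y} {g} {a} {b} a≢b ya≈g yb≈ε x =
    by-cases x (countable-≟ cD x a) (countable-≟ cD x b)
    where
    by-cases : ∀ x → Dec (x ≡ a) → Dec (x ≡ b) →
               [ a ↦ g ] x ∙ [ b ↦ g ] x ⁻¹ ≈ y x ∙ y (swap a b x) ⁻¹
    by-cases .a (yes ≡.refl) _ = begin
      [ a ↦ g ] a ∙ [ b ↦ g ] a ⁻¹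
        ≡⟨ ≡.cong₂ (λ u w → u ∙ w ⁻¹) (single-at a g ≡.refl) (single-off b g a≢b) ⟩
      g ∙ ε ⁻¹                 ≈⟨ ∙-cong (sym ya≈g) (⁻¹-cong (sym yb≈ε)) ⟩
      y a ∙ y b ⁻¹             ≡⟨ ≡.cong (λ z → y a ∙ y z ⁻¹) (swap-left a b) ⟨
      y a ∙ y (swap a b a) ⁻¹  ∎
    by-cases .b (no b≢a) (yes ≡.refl) = begin
      [ a ↦ g ] b ∙ [ b ↦ g ] b ⁻¹
        ≡⟨ ≡.cong₂ (λ u w → u ∙ w ⁻¹) (single-off a g b≢a) (single-at b g ≡.refl) ⟩
      ε ∙ g ⁻¹                 ≈⟨ ∙-cong (sym yb≈ε) (⁻¹-cong (sym ya≈g)) ⟩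
      y b ∙ y a ⁻¹             ≡⟨ ≡.cong (λ z → y b ∙ y z ⁻¹) (swap-right a b) ⟨
      y b ∙ y (swap a b b) ⁻¹  ∎
    by-cases x (no x≢a) (no x≢b) = begin
      [ a ↦ g ] x ∙ [ b ↦ g ] x ⁻¹
        ≡⟨ ≡.cong₂ (λ u w → u ∙ w ⁻¹) (single-off a g x≢a) (single-off b g x≢b) ⟩
      ε ∙ ε ⁻¹                 ≈⟨ inverseʳ ε ⟩
      ε                        ≈⟨ inverseʳ (y x) ⟨
      y x ∙ y x ⁻¹             ≡⟨ ≡.cong (λ z → y x ∙ y z ⁻¹) (swap-other a b x≢a x≢b) ⟨
      y x ∙ y (swap a b x) ⁻¹  ∎

  spreads-of-reversible : ∀ {y g a b} → PermSum V y → PermSum V (-v y) →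
                          a ≢ b → y a ≈ g → y b ≈ ε → Spreads g
  spreads-of-reversible {y} {g} {a} {b} y∈ -y∈ a≢b ya≈g yb≈ε α β
    with countable-≟ cD α β
  ... | yes ≡.refl = permSum-0 λ x → inverseʳ ([ α ↦ g ] x)
  ... | no α≢β = permSum-respˡ
    (single-difference α≢β (trans (reflexive (≡.cong y πα≡a)) ya≈g)
                           (trans (reflexive (≡.cong y πβ≡b)) yb≈ε))
    (permSum-+ (permSum-∘ π y∈) (permSum-∘ (transposition α β) (permSum-∘ π -y∈)))
    where
    π = proj₁ (permutation-mapping-pair α≢β a≢b)
    πα≡a = proj₁ (proj₂ (permutation-mapping-pair α≢β a≢b))
    πβ≡b = proj₂ (proj₂ (permutation-mapping-pair α≢β a≢b))

  module _ (reversible : Reversible V) (δ : D) (V-vanishes-at-δ : ∀ {v} → v ∈ V → v δ ≈ ε) where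

    spreads-generator : ∀ {v} → v ∈ V → ∀ γ → Spreads (v γ)
    spreads-generator v∈V γ with countable-≟ cD γ δ
    ... | yes ≡.refl = spreads-cong (sym (V-vanishes-at-δ v∈V)) spreads-ε
    ... | no γ≢δ = spreads-of-reversible (proj₁ (reversible v∈V)) (proj₂ (reversible v∈V))
                                         γ≢δ refl (V-vanishes-at-δ v∈V)

    spreads-InGen : ∀ {g} → InGen V g → Spreads g
    spreads-InGen (gen v∈V γ)   = spreads-generator v∈V γ
    spreads-InGen zero          = spreads-ε
    spreads-InGen (add g∈ h∈)   = spreads-∙ (spreads-InGen g∈) (spreads-InGen h∈)
    spreads-InGen (neg g∈)      = spreads-⁻¹ (spreads-InGen g∈)
    spreads-InGen (resp g≈h g∈) = spreads-cong g≈h (spreads-InGen g∈)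

lemma14 : {c ℓ : Level} (G : AbelianGroup c ℓ) (D : Set) (cD : Countable D)
          (V : List (DataVectors.DV G D)) →
          All (DataVectors.FiniteSupport G D) V →
          DataVectors.Reversible G D V →
          Σ D (λ δ → ∀ {v} → v ∈ V → AbelianGroup._≈_ G (v δ) (AbelianGroup.ε G)) →
          ∀ g → DataVectors.InGen G D V g → (α β : D) →
          DataVectors.PermSum G D V
            (DataVectors._-v_ G D (DataVectors.single G D cD α g) (DataVectors.single G D cD β g))
lemma14 G D cD V _ reversible (δ , V-vanishes-at-δ) g g∈ =
  Spreading.spreads-InGen G D cD V reversible δ V-vanishes-at-δ g∈
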